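{- Let $m\ge1$ and $l\ge1$ be integers and put \[ D_{m,l}=\prod_{\substack{p\le \frac{m+1}{2}\\ p \text{ prime}}}p^{\mu_p\, v_p((l-1)!)},\qquad \mu_p=\min_{0\le j\le m}\left\{\left\lfloor \frac{j}{p}\right\rfloor +\left\lfloor \frac{m-j}{p}\right\rfloor\right\}. \] Then $D_{m,l}^{ -1} B^*_{k,j}(t) \in \mathbb Z[t]$ for all $k, j = 0, 1, \ldots, m$.
   Context: $v_p$ denotes the $p$-adic valuation. For $k\in\{0,\dots,m\}$ let $l^{(k)}_i=l$ for $i\ne k$ and $l^{(k)}_k=l-1$ ($i=0,\dots,m$), and $L=(m+1)l-1$. For $j\in\{0,\dots,m\}$ define $\sigma^{(k,j)}_i$ by $\prod_{i=0}^m(i-j-w)^{l^{(k)}_i}=\sum_{i=0}^L\sigma^{(k,j)}_i w^i$ and \[ B^*_{k,j}(t)=\frac{1}{(l-1)!}\sum_{i=0}^{L} i!\,\sigma^{(k,j)}_i\,t^{L-i}. \] -}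

module Defs where

open import Data.Nat as ℕ using (ℕ; zero; suc; _≤ᵇ_; _≡ᵇ_; _⊓_)
open import Data.Nat.DivMod using (_/_; _%_)
open import Data.Nat using (_!)
open import Data.Nat.Primality using (prime?)
open import Data.Integer as ℤ using (ℤ; +_)
open import Data.List using (List; []; _∷_; map; foldr; upTo)
open import Data.Bool using (Bool; true; false; if_then_else_; _∧_)
open import Relation.Nullary.Decidable using (does)

-- Polynomials over ℤ as coefficient lists, lowest degree first.

Poly : Set
Poly = List ℤ

padd : Poly → Poly → Poly
padd []       q        = q
padd (a ∷ p)  []       = a ∷ p
padd (a ∷ p)  (b ∷ q)  = (a ℤ.+ b) ∷ padd p q

pmul : Poly → Poly → Poly
pmul []      q = []
pmul (a ∷ p) q = padd (map (a ℤ.*_) q) (+ 0 ∷ pmul p q)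

ppow : Poly → ℕ → Poly
ppow p zero    = + 1 ∷ []
ppow p (suc n) = pmul p (ppow p n)

coeff : Poly → ℕ → ℤ
coeff []      _       = + 0
coeff (a ∷ p) zero    = a
coeff (a ∷ p) (suc i) = coeff p i

lk : ℕ → ℕ → ℕ → ℕ
lk l k i = if i ≡ᵇ k then l ℕ.∸ 1 else l

Lval : ℕ → ℕ → ℕ
Lval m l = (suc m) ℕ.* l ℕ.∸ 1

sigmaPoly : ℕ → ℕ → ℕ → ℕ → Poly
sigmaPoly m l k j =
  foldr (λ i acc → pmul (ppow (((+ i) ℤ.- (+ j)) ∷ ℤ.-[1+ 0 ] ∷ []) (lk l k i)) acc)
        (+ 1 ∷ [])
        (upTo (suc m))

sigma : ℕ → ℕ → ℕ → ℕ → ℕ → ℤ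
sigma m l k j i = coeff (sigmaPoly m l k j) i

-- (l-1)! · (coefficient of t^{L-i} in B*_{k,j}(t)) = i! σ^{(k,j)}_i
BstarNum : ℕ → ℕ → ℕ → ℕ → ℕ → ℤ
BstarNum m l k j i = (+ (i !)) ℤ.* sigma m l k j i

-- p-adic valuation of a natural number (v_p(0) := 0; only used for n ≥ 1).
-- vAux fuel p n: repeatedly divide by p while p ∣ n; fuel n suffices.

vAux : ℕ → ℕ → ℕ → ℕ
vAux zero    _               _ = 0
vAux (suc f) zero            _ = 0
vAux (suc f) (suc zero)      _ = 0
vAux (suc f) (suc (suc q))   zero = 0
vAux (suc f) p@(suc (suc q)) n@(suc _) =
  if (n % p) ≡ᵇ 0 then suc (vAux f p (n / p)) else 0

vp : ℕ → ℕ → ℕ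
vp p n = vAux n p n

floorDiv : ℕ → ℕ → ℕ
floorDiv a zero    = 0
floorDiv a (suc q) = a / suc q

muTerm : ℕ → ℕ → ℕ → ℕ
muTerm m p j = floorDiv j p ℕ.+ floorDiv (m ℕ.∸ j) p

minList : ℕ → List ℕ → ℕ
minList d []       = d
minList d (x ∷ xs) = foldr _⊓_ x xs

mu : ℕ → ℕ → ℕ
mu m p = minList 0 (map (muTerm m p) (upTo (suc m)))

-- D_{m,l} = ∏_{p prime, p ≤ (m+1)/2} p^{μ_p v_p((l-1)!)}
-- (p ≤ (m+1)/2  ⇔  2p ≤ m+1; p ranges over 0..m+1)
Dml : ℕ → ℕ → ℕ
Dml m l =
  foldr (λ p acc →
           if does (prime? p) ∧ (2 ℕ.* p ≤ᵇ suc m)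
           then (p ℕ.^ (mu m p ℕ.* vp p ((l ℕ.∸ 1) !))) ℕ.* acc
           else acc)
        1
        (upTo (suc (suc m)))

module Submission where

-- Let n = l − 1 and call a polynomial f "Hurwitz divisible" by d when d ∣ i!·[wⁱ]f for
-- every i.  Since i! = C(i,s)·s!·(i−s)!, a product of polynomials Hurwitz divisible by d₁
-- and d₂ is Hurwitz divisible by d₁d₂.  The scaled coefficients of (c − w)^e are
-- ±e(e−1)⋯(e−i+1)·c^(e−i); for e ≥ n they are divisible by n! when c = 0, and by
-- p^(v_p(n!)) when p ∣ c, because e! = e⋯(e−i+1)·(e−i)! and v_p((e−i)!) ≤ e − i.
-- In ∏ᵢ (i − j − w)^(eᵢ) the factor i = j has c = 0, and p ∣ i − j for
-- ⌊j/p⌋ + ⌊(m−j)/p⌋ ≥ μ_p further indices i, so n!·p^(μ_p v_p(n!)) divides every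
-- i!σᵢ, for every prime p.  The prime powers being pairwise coprime, D_{m,l}·n! does too.

open import Defs
open import Data.List using (List; []; _∷_; map; foldr)
open import Data.Nat.ListAction using (sum; product)
open import Relation.Binary.PropositionalEquality
  using (_≡_; _≢_; refl; sym; trans; cong; cong₂; subst; module ≡-Reasoning)

-- Falling factorials
module _ where
  open import Data.Nat
  open import Data.Nat.Properties
  open import Data.Nat.Tactic.RingSolver using (solve-∀)

  fallingFactorial : ℕ → ℕ → ℕ
  fallingFactorial e       zero    = 1
  fallingFactorial zero    (suc i) = 0
  fallingFactorial (suc e) (suc i) = suc e * fallingFactorial e i

  fallingFactorial-> : ∀ {e i} → e < i → fallingFactorial e i ≡ 0
  fallingFactorial-> {zero}  {suc i} _         = refl
  fallingFactorial-> {suc e} {suc i} (s≤s e<i) =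
    trans (cong (suc e *_) (fallingFactorial-> e<i)) (*-zeroʳ (suc e))

  fallingFactorial*[e∸i]!≡e! : ∀ {e i} → i ≤ e → fallingFactorial e i * (e ∸ i) ! ≡ e !
  fallingFactorial*[e∸i]!≡e! {e}     {zero}  _         = +-identityʳ (e !)
  fallingFactorial*[e∸i]!≡e! {suc e} {suc i} (s≤s i≤e) =
    trans (*-assoc (suc e) (fallingFactorial e i) _) (cong (suc e *_) (fallingFactorial*[e∸i]!≡e! i≤e))

  fallingFactorial-suc : ∀ e i →
    fallingFactorial e (suc i) + suc i * fallingFactorial e i ≡ suc e * fallingFactorial e i
  fallingFactorial-suc zero    zero    = refl
  fallingFactorial-suc zero    (suc i) = *-zeroʳ (suc (suc i))
  fallingFactorial-suc (suc e) zero    = linear e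
    where
    linear : ∀ e → suc e * 1 + 1 * 1 ≡ suc (suc e) * 1
    linear = solve-∀
  fallingFactorial-suc (suc e) (suc i) = begin
      suc e * F₁ + suc (suc i) * (suc e * F₀)
    ≡⟨ regroup (suc e) F₁ (suc i) F₀ ⟩
      suc e * (F₁ + suc i * F₀) + suc e * F₀
    ≡⟨ cong (λ x → suc e * x + suc e * F₀) (fallingFactorial-suc e i) ⟩
      suc e * (suc e * F₀) + suc e * F₀
    ≡⟨ collect (suc e) F₀ ⟩
      suc (suc e) * (suc e * F₀) ∎
    where
    open ≡-Reasoning
    F₀ = fallingFactorial e i
    F₁ = fallingFactorial e (suc i)
    regroup : ∀ a x b y → a * x + (1 + b) * (a * y) ≡ a * (x + b * y) + a * y
    regroup = solve-∀
    collect : ∀ a y → a * (a * y) + a * y ≡ (1 + a) * (a * y)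
    collect = solve-∀

-- Coefficients of products and Hurwitz divisibility
module _ where
  open import Data.Nat as ℕ using (ℕ; zero; suc; _!; _∸_; s≤s; z≤n)
  import Data.Nat.Properties as ℕ
  import Data.Nat.Divisibility as ℕ
  open import Data.Nat.Combinatorics using (k![n∸k]!∣n!)
  open import Data.Integer
    using (ℤ; +_; -1ℤ; _+_; _-_; _*_; _^_; ∣_∣)
  open import Data.Integer.Properties
    using (+-identityˡ; +-identityʳ; *-identityʳ; *-zeroˡ; *-zeroʳ; *-distribˡ-+; pos-*; pos-+; abs-*;
           m-n≡m⊖n; ∣⊖∣-≤; ∣m⊖n∣≡∣n⊖m∣)
  open import Data.Sum using (inj₁; inj₂)
  open import Data.Integer.Divisibility.Signed using (_∣_; divides; ∣m∣n⇒∣m+n; ∣n⇒∣m*n; ∣ᵤ⇒∣)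
  open import Data.Integer.Tactic.RingSolver using (solve-∀)
  open ≡-Reasoning

  sumBelow : ℕ → (ℕ → ℤ) → ℤ
  sumBelow zero    h = + 0
  sumBelow (suc n) h = h 0 + sumBelow n (λ s → h (suc s))

  *-distribˡ-sumBelow : ∀ c n h → c * sumBelow n h ≡ sumBelow n (λ s → c * h s)
  *-distribˡ-sumBelow c zero    h = *-zeroʳ c
  *-distribˡ-sumBelow c (suc n) h =
    trans (*-distribˡ-+ c (h 0) _) (cong (_+_ (c * h 0)) (*-distribˡ-sumBelow c n _))

  sumBelow-0* : ∀ n h → sumBelow n (λ s → + 0 * h s) ≡ + 0
  sumBelow-0* n h = trans (sym (*-distribˡ-sumBelow (+ 0) n h)) (*-zeroˡ (sumBelow n h))

  ∣-sumBelow : ∀ {d} n h → (∀ s → s ℕ.< n → d ∣ h s) → d ∣ sumBelow n h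
  ∣-sumBelow zero    h _ = divides (+ 0) refl
  ∣-sumBelow (suc n) h d∣h =
    ∣m∣n⇒∣m+n (d∣h 0 (s≤s z≤n))
              (∣-sumBelow n (λ s → h (suc s)) (λ s s<n → d∣h (suc s) (s≤s s<n)))

  coeff-padd : ∀ f g i → coeff (padd f g) i ≡ coeff f i + coeff g i
  coeff-padd []      g       i       = sym (+-identityˡ _)
  coeff-padd (a ∷ f) []      i       = sym (+-identityʳ _)
  coeff-padd (a ∷ f) (b ∷ g) zero    = refl
  coeff-padd (a ∷ f) (b ∷ g) (suc i) = coeff-padd f g i

  coeff-map-* : ∀ a f i → coeff (map (a *_) f) i ≡ a * coeff f i
  coeff-map-* a []      i       = sym (*-zeroʳ a)
  coeff-map-* a (b ∷ f) zero    = refl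
  coeff-map-* a (b ∷ f) (suc i) = coeff-map-* a f i

  coeff-pmul : ∀ f g i → coeff (pmul f g) i ≡ sumBelow (suc i) (λ s → coeff f s * coeff g (i ∸ s))
  coeff-pmul []      g i       = sym (sumBelow-0* (suc i) (λ s → coeff g (i ∸ s)))
  coeff-pmul (a ∷ f) g zero    = begin
      coeff (padd (map (a *_) g) (+ 0 ∷ pmul f g)) 0  ≡⟨ coeff-padd (map (a *_) g) _ 0 ⟩
      coeff (map (a *_) g) 0 + + 0                    ≡⟨ cong (_+ + 0) (coeff-map-* a g 0) ⟩
      a * coeff g 0 + + 0                             ∎
  coeff-pmul (a ∷ f) g (suc i) = begin
      coeff (padd (map (a *_) g) (+ 0 ∷ pmul f g)) (suc i)
    ≡⟨ coeff-padd (map (a *_) g) _ (suc i) ⟩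
      coeff (map (a *_) g) (suc i) + coeff (pmul f g) i
    ≡⟨ cong₂ _+_ (coeff-map-* a g (suc i)) (coeff-pmul f g i) ⟩
      a * coeff g (suc i) + sumBelow (suc i) (λ s → coeff f s * coeff g (i ∸ s)) ∎

  private
    *-pres-∣ : ∀ {a b x y} → a ∣ x → b ∣ y → a * b ∣ x * y
    *-pres-∣ {a} {b} (divides q refl) (divides r refl) = divides (q * r) (regroup q a r b)
      where
      regroup : ∀ q a r b → q * a * (r * b) ≡ q * r * (a * b)
      regroup = solve-∀

  HurwitzDivisible : ℕ → Poly → Set
  HurwitzDivisible d f = ∀ i → + d ∣ + (i !) * coeff f i

  hurwitzDivisible-1 : ∀ f → HurwitzDivisible 1 f
  hurwitzDivisible-1 f i = divides (+ (i !) * coeff f i) (sym (*-identityʳ _))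

  pmul-hurwitzDivisible : ∀ {a b f g} → HurwitzDivisible a f → HurwitzDivisible b g →
    HurwitzDivisible (a ℕ.* b) (pmul f g)
  pmul-hurwitzDivisible {a} {b} {f} {g} Hf Hg i =
    subst (+ (a ℕ.* b) ∣_) (sym expand) (∣-sumBelow (suc i) (λ s → + (i !) * term s) term-divisible)
    where
    term : ℕ → ℤ
    term s = coeff f s * coeff g (i ∸ s)
    expand : + (i !) * coeff (pmul f g) i ≡ sumBelow (suc i) (λ s → + (i !) * term s)
    expand = trans (cong (+ (i !) *_) (coeff-pmul f g i)) (*-distribˡ-sumBelow (+ (i !)) (suc i) term)
    term-divisible : ∀ s → s ℕ.< suc i → + (a ℕ.* b) ∣ + (i !) * term s
    term-divisible s (s≤s s≤i) with k![n∸k]!∣n! s≤i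
    ... | ℕ.divides w i!≡w*s!*[i∸s]! =
      subst (+ (a ℕ.* b) ∣_) (sym binomial)
        (∣n⇒∣m*n (+ w) (subst (_∣ _) (sym (pos-* a b)) (*-pres-∣ (Hf s) (Hg (i ∸ s)))))
      where
      x = coeff f s
      y = coeff g (i ∸ s)
      regroup : ∀ w a b x y → w * (a * b) * (x * y) ≡ w * ((a * x) * (b * y))
      regroup = solve-∀
      binomial : + (i !) * (x * y) ≡ + w * ((+ (s !) * x) * (+ ((i ∸ s) !) * y))
      binomial = begin
          + (i !) * (x * y)
        ≡⟨ cong (λ n → + n * (x * y)) i!≡w*s!*[i∸s]! ⟩
          + (w ℕ.* (s ! ℕ.* (i ∸ s) !)) * (x * y)
        ≡⟨ cong (_* (x * y)) (trans (pos-* w _) (cong (+ w *_) (pos-* (s !) ((i ∸ s) !)))) ⟩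
          + w * (+ (s !) * + ((i ∸ s) !)) * (x * y)
        ≡⟨ regroup (+ w) (+ (s !)) (+ ((i ∸ s) !)) x y ⟩
          + w * ((+ (s !) * x) * (+ ((i ∸ s) !) * y)) ∎

  foldr-pmul-hurwitzDivisible : ∀ (h : ℕ → ℕ) (fac : ℕ → Poly) xs →
    (∀ x → HurwitzDivisible (h x) (fac x)) →
    HurwitzDivisible (product (map h xs)) (foldr (λ x acc → pmul (fac x) acc) (+ 1 ∷ []) xs)
  foldr-pmul-hurwitzDivisible h fac []       H = hurwitzDivisible-1 (+ 1 ∷ [])
  foldr-pmul-hurwitzDivisible h fac (x ∷ xs) H =
    pmul-hurwitzDivisible {f = fac x} (H x) (foldr-pmul-hurwitzDivisible h fac xs H)

  linearFactor : ℤ → Poly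
  linearFactor c = c ∷ -1ℤ ∷ []

  coeff-linearFactor*-zero : ∀ c q → coeff (pmul (linearFactor c) q) 0 ≡ c * coeff q 0
  coeff-linearFactor*-zero c q = trans (coeff-pmul (linearFactor c) q 0) (+-identityʳ (c * coeff q 0))

  coeff-linearFactor*-suc : ∀ c q i →
    coeff (pmul (linearFactor c) q) (suc i) ≡ c * coeff q (suc i) - coeff q i
  coeff-linearFactor*-suc c q i = begin
      coeff (pmul (linearFactor c) q) (suc i)
    ≡⟨ coeff-pmul (linearFactor c) q (suc i) ⟩
      c * coeff q (suc i) + (-1ℤ * coeff q i + sumBelow i (λ s → + 0 * coeff q (i ∸ suc s)))
    ≡⟨ cong (λ z → c * coeff q (suc i) + (-1ℤ * coeff q i + z))
            (sumBelow-0* i (λ s → coeff q (i ∸ suc s))) ⟩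
      c * coeff q (suc i) + (-1ℤ * coeff q i + + 0)
    ≡⟨ simplify c (coeff q (suc i)) (coeff q i) ⟩
      c * coeff q (suc i) - coeff q i ∎
    where
    simplify : ∀ c x y → c * x + (-1ℤ * y + + 0) ≡ c * x - y
    simplify = solve-∀

  fallingFactorial-shift : ∀ c e i →
    c * (+ fallingFactorial e (suc i) * c ^ (e ∸ suc i)) ≡ + fallingFactorial e (suc i) * c ^ (e ∸ i)
  fallingFactorial-shift c e i with ℕ.<-≤-connex i e
  ... | inj₁ i<e rewrite ℕ.+-∸-assoc 1 i<e = swap c (+ fallingFactorial e (suc i)) (c ^ (e ∸ suc i))
    where
    swap : ∀ c f x → c * (f * x) ≡ f * (c * x)
    swap = solve-∀
  ... | inj₂ e≤i rewrite fallingFactorial-> (s≤s e≤i) =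
    trans (cong (c *_) (*-zeroˡ (c ^ (e ∸ suc i)))) (trans (*-zeroʳ c) (sym (*-zeroˡ (c ^ (e ∸ i)))))

  coeff-linearFactor^ : ∀ c e i →
    + (i !) * coeff (ppow (linearFactor c) e) i ≡ -1ℤ ^ i * + fallingFactorial e i * c ^ (e ∸ i)
  coeff-linearFactor^ c zero    zero    = refl
  coeff-linearFactor^ c zero    (suc i) =
    trans (*-zeroʳ (+ (suc i !))) (sym (cong (_* c ^ 0) (*-zeroʳ (-1ℤ ^ suc i))))
  coeff-linearFactor^ c (suc e) zero    = begin
      + 1 * coeff (pmul (linearFactor c) q) 0  ≡⟨ cong (+ 1 *_) (coeff-linearFactor*-zero c q) ⟩
      + 1 * (c * coeff q 0)                    ≡⟨ pull c (coeff q 0) ⟩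
      c * (+ 1 * coeff q 0)                    ≡⟨ cong (c *_) (coeff-linearFactor^ c e 0) ⟩
      c * (+ 1 * + 1 * c ^ e)                  ≡⟨ push c (c ^ e) ⟩
      + 1 * + 1 * (c * c ^ e)                  ∎
    where
    q = ppow (linearFactor c) e
    pull : ∀ c x → + 1 * (c * x) ≡ c * (+ 1 * x)
    pull = solve-∀
    push : ∀ c y → c * (+ 1 * + 1 * y) ≡ + 1 * + 1 * (c * y)
    push = solve-∀
  coeff-linearFactor^ c (suc e) (suc i) = begin
      + (suc i !) * coeff (pmul (linearFactor c) q) (suc i)
    ≡⟨ cong₂ _*_ (pos-* (suc i) (i !)) (coeff-linearFactor*-suc c q i) ⟩
      + suc i * + (i !) * (c * coeff q (suc i) - coeff q i)
    ≡⟨ expand (+ suc i) (+ (i !)) c (coeff q (suc i)) (coeff q i) ⟩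
      c * (+ suc i * + (i !) * coeff q (suc i)) - + suc i * (+ (i !) * coeff q i)
    ≡⟨ cong₂ (λ x y → c * x - + suc i * y)
         (trans (cong (_* coeff q (suc i)) (sym (pos-* (suc i) (i !)))) (coeff-linearFactor^ c e (suc i)))
         (coeff-linearFactor^ c e i) ⟩
      c * (-1ℤ ^ suc i * + F₁ * c ^ (e ∸ suc i)) - + suc i * (-1ℤ ^ i * + F₀ * c ^ (e ∸ i))
    ≡⟨ regroup (-1ℤ ^ i) c (+ F₁) (c ^ (e ∸ suc i)) (+ suc i) (+ F₀) (c ^ (e ∸ i)) ⟩
      -1ℤ ^ suc i * (c * (+ F₁ * c ^ (e ∸ suc i)) + + suc i * + F₀ * c ^ (e ∸ i))
    ≡⟨ cong (λ x → -1ℤ ^ suc i * (x + + suc i * + F₀ * c ^ (e ∸ i))) (fallingFactorial-shift c e i) ⟩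
      -1ℤ ^ suc i * (+ F₁ * c ^ (e ∸ i) + + suc i * + F₀ * c ^ (e ∸ i))
    ≡⟨ factor (-1ℤ ^ suc i) (+ F₁) (+ suc i) (+ F₀) (c ^ (e ∸ i)) ⟩
      -1ℤ ^ suc i * (+ F₁ + + suc i * + F₀) * c ^ (e ∸ i)
    ≡⟨ cong (λ x → -1ℤ ^ suc i * x * c ^ (e ∸ i)) recurrence ⟩
      -1ℤ ^ suc i * + (suc e ℕ.* F₀) * c ^ (e ∸ i) ∎
    where
    q = ppow (linearFactor c) e
    F₀ = fallingFactorial e i
    F₁ = fallingFactorial e (suc i)
    expand : ∀ a b c x y → a * b * (c * x - y) ≡ c * (a * b * x) - a * (b * y)
    expand = solve-∀
    regroup : ∀ s c f₁ x n f₀ y →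
      c * (-1ℤ * s * f₁ * x) - n * (s * f₀ * y) ≡ -1ℤ * s * (c * (f₁ * x) + n * f₀ * y)
    regroup = solve-∀
    factor : ∀ s f₁ n f₀ y → s * (f₁ * y + n * f₀ * y) ≡ s * (f₁ + n * f₀) * y
    factor = solve-∀
    recurrence : + F₁ + + suc i * + F₀ ≡ + (suc e ℕ.* F₀)
    recurrence = begin
      + F₁ + + suc i * + F₀      ≡⟨ cong (_+_ (+ F₁)) (sym (pos-* (suc i) F₀)) ⟩
      + F₁ + + (suc i ℕ.* F₀)    ≡⟨ sym (pos-+ F₁ _) ⟩
      + (F₁ ℕ.+ suc i ℕ.* F₀)    ≡⟨ cong +_ (fallingFactorial-suc e i) ⟩
      + (suc e ℕ.* F₀)           ∎

  abs-^ : ∀ c r → ∣ c ^ r ∣ ≡ ∣ c ∣ ℕ.^ r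
  abs-^ c zero    = refl
  abs-^ c (suc r) = trans (abs-* c (c ^ r)) (cong (∣ c ∣ ℕ.*_) (abs-^ c r))

  ∣+m-+n∣≡∣m-n∣ : ∀ m n → ∣ + m - + n ∣ ≡ ℕ.∣ m - n ∣
  ∣+m-+n∣≡∣m-n∣ m n with ℕ.≤-total m n
  ... | inj₁ m≤n = trans (cong ∣_∣ (m-n≡m⊖n m n)) (trans (∣⊖∣-≤ m≤n) (sym (ℕ.m≤n⇒∣m-n∣≡n∸m m≤n)))
  ... | inj₂ n≤m = trans (cong ∣_∣ (m-n≡m⊖n m n))
    (trans (∣m⊖n∣≡∣n⊖m∣ m n) (trans (∣⊖∣-≤ n≤m) (sym (ℕ.m≤n⇒∣n-m∣≡n∸m n≤m))))

  linearFactor^-hurwitzDivisible : ∀ {d} c e →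
    (∀ i → d ℕ.∣ fallingFactorial e i ℕ.* ∣ c ∣ ℕ.^ (e ∸ i)) →
    HurwitzDivisible d (ppow (linearFactor c) e)
  linearFactor^-hurwitzDivisible {d} c e H i = ∣ᵤ⇒∣ (subst (d ℕ.∣_) (sym abs-coeff) (H i))
    where
    F = fallingFactorial e i
    abs-coeff : ∣ + (i !) * coeff (ppow (linearFactor c) e) i ∣ ≡ F ℕ.* ∣ c ∣ ℕ.^ (e ∸ i)
    abs-coeff = begin
        ∣ + (i !) * coeff (ppow (linearFactor c) e) i ∣
      ≡⟨ cong ∣_∣ (coeff-linearFactor^ c e i) ⟩
        ∣ -1ℤ ^ i * + F * c ^ (e ∸ i) ∣
      ≡⟨ trans (abs-* (-1ℤ ^ i * + F) (c ^ (e ∸ i)))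
               (cong₂ ℕ._*_ (abs-* (-1ℤ ^ i) (+ F)) (abs-^ c (e ∸ i))) ⟩
        ∣ -1ℤ ^ i ∣ ℕ.* F ℕ.* ∣ c ∣ ℕ.^ (e ∸ i)
      ≡⟨ cong (λ x → x ℕ.* F ℕ.* ∣ c ∣ ℕ.^ (e ∸ i)) (trans (abs-^ -1ℤ i) (ℕ.^-zeroˡ i)) ⟩
        1 ℕ.* F ℕ.* ∣ c ∣ ℕ.^ (e ∸ i)
      ≡⟨ cong (ℕ._* ∣ c ∣ ℕ.^ (e ∸ i)) (ℕ.*-identityˡ F) ⟩
        F ℕ.* ∣ c ∣ ℕ.^ (e ∸ i) ∎

-- Prime powers dividing factorials
module _ where
  open import Data.Nat
  open import Data.Nat.Properties
  open import Data.Nat.Divisibility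
  open import Data.Nat.DivMod using (_/_; _%_; m≡m%n+[m/n]*n; m%n<n; m/n<m; m*[n/m]≡n)
  open import Data.Nat.Primality using (Prime; euclidsLemma; prime⇒nonZero; prime⇒nonTrivial)
  open import Data.Nat.Induction using (<-rec)
  open import Data.Nat.Tactic.RingSolver using (solve-∀)
  open import Data.Bool using (true; false; T)
  open import Data.Empty using (⊥-elim)
  open import Data.Product using (∃-syntax; _×_; _,_)
  open import Data.Sum using (inj₁; inj₂)
  open import Relation.Nullary using (¬_; yes; no)

  ^-monoˡ-∣ : ∀ {a b} r → a ∣ b → a ^ r ∣ b ^ r
  ^-monoˡ-∣ zero    _   = ∣-refl
  ^-monoˡ-∣ (suc r) a∣b = *-pres-∣ a∣b (^-monoˡ-∣ r a∣b)

  ^-monoʳ-∣ : ∀ a {m n} → m ≤ n → a ^ m ∣ a ^ n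
  ^-monoʳ-∣ a {m} {n} m≤n = divides (a ^ (n ∸ m)) (begin
    a ^ n              ≡⟨ cong (a ^_) (sym (m∸n+n≡m m≤n)) ⟩
    a ^ (n ∸ m + m)    ≡⟨ ^-distribˡ-+-* a (n ∸ m) m ⟩
    a ^ (n ∸ m) * a ^ m ∎)
    where open ≡-Reasoning

  prime∤1 : ∀ {p} → Prime p → ¬ p ∣ 1
  prime∤1 p-prime p∣1 = nonTrivial⇒≢1 {{prime⇒nonTrivial p-prime}} (∣1⇒≡1 p∣1)

  prime∣^⇒prime∣ : ∀ {q} x e → Prime q → q ∣ x ^ e → q ∣ x
  prime∣^⇒prime∣ x zero    q-prime q∣1 = ⊥-elim (prime∤1 q-prime q∣1)
  prime∣^⇒prime∣ x (suc e) q-prime q∣x^e+1 with euclidsLemma x (x ^ e) q-prime q∣x^e+1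
  ... | inj₁ q∣x   = q∣x
  ... | inj₂ q∣x^e = prime∣^⇒prime∣ x e q-prime q∣x^e

  prime∤m*n : ∀ {p} m n → Prime p → ¬ p ∣ m → ¬ p ∣ n → ¬ p ∣ m * n
  prime∤m*n m n p-prime p∤m p∤n p∣mn with euclidsLemma m n p-prime p∣mn
  ... | inj₁ p∣m = p∤m p∣m
  ... | inj₂ p∣n = p∤n p∣n

  p^k∣m*n⇒p^k∣m : ∀ {p n} → Prime p → ¬ p ∣ n → ∀ k m → p ^ k ∣ m * n → p ^ k ∣ m
  p^k∣m*n⇒p^k∣m p-prime p∤n zero    m _ = 1∣ m
  p^k∣m*n⇒p^k∣m {p} {n} p-prime p∤n (suc k) m p^k+1∣mn
    with euclidsLemma m n p-prime (∣-trans (m∣m*n (p ^ k)) p^k+1∣mn)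
  ... | inj₂ p∣n = ⊥-elim (p∤n p∣n)
  ... | inj₁ (divides m′ refl) =
    subst (_∣ m′ * p) (*-comm (p ^ k) p)
      (*-monoˡ-∣ p (p^k∣m*n⇒p^k∣m p-prime p∤n k m′ p^k∣m′n))
    where
    instance _ = prime⇒nonZero p-prime
    p^k∣m′n : p ^ k ∣ m′ * n
    p^k∣m′n = *-cancelˡ-∣ p (subst (p * p ^ k ∣_) (swap m′ p n) p^k+1∣mn)
      where
      swap : ∀ a b c → a * b * c ≡ b * (a * c)
      swap = solve-∀

  module _ {p : ℕ} (p-prime : Prime p) where
    private
      instance _ = prime⇒nonZero p-prime

      pred[p]<p : pred p < p
      pred[p]<p = subst (pred p <_) (suc-pred p) (n<1+n (pred p))

    FactorialSplit : ℕ → ℕ → Set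
    FactorialSplit r q = ∃[ u ] ¬ p ∣ u × r ! ≡ p ^ q * q ! * u

    factorialSplit-suc : ∀ {r q} → ¬ p ∣ suc r → FactorialSplit r q → FactorialSplit (suc r) q
    factorialSplit-suc {r} {q} p∤r+1 (u , p∤u , r!≡) =
      suc r * u , prime∤m*n (suc r) u p-prime p∤r+1 p∤u ,
      trans (cong (suc r *_) r!≡) (regroup (suc r) (p ^ q) (q !) u)
      where
      regroup : ∀ a b c d → a * (b * c * d) ≡ b * c * (a * d)
      regroup = solve-∀

    factorialSplit-+ : ∀ {q} t → t < p → FactorialSplit (p * q) q → FactorialSplit (p * q + t) q
    factorialSplit-+ {q} zero    _   split =
      subst (λ r → FactorialSplit r q) (sym (+-identityʳ (p * q))) split
    factorialSplit-+ {q} (suc t) t<p split =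
      subst (λ r → FactorialSplit r q) (sym (+-suc (p * q) t))
        (factorialSplit-suc {q = q} p∤r+1 (factorialSplit-+ t (<-trans (n<1+n t) t<p) split))
      where
      p∤r+1 : ¬ p ∣ suc (p * q + t)
      p∤r+1 p∣r+1 =
        <⇒≱ t<p (∣⇒≤ (∣m+n∣m⇒∣n (subst (p ∣_) (sym (+-suc (p * q) t)) p∣r+1) (m∣m*n q)))

    factorialSplit-* : ∀ q → FactorialSplit (p * q) q
    factorialSplit-* zero =
      subst (λ r → FactorialSplit r 0) (sym (*-zeroʳ p)) (1 , prime∤1 p-prime , refl)
    factorialSplit-* (suc q) with factorialSplit-+ (pred p) pred[p]<p (factorialSplit-* q)
    ... | u , p∤u , r!≡ = subst (λ r → FactorialSplit r (suc q)) r+1≡p[q+1] (u , p∤u , r+1!≡)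
      where
      r = p * q + pred p
      r+1≡p[q+1] : suc r ≡ p * suc q
      r+1≡p[q+1] = trans (sym (+-suc (p * q) (pred p)))
        (trans (cong (p * q +_) (suc-pred p)) (trans (+-comm (p * q) p) (sym (*-suc p q))))
      regroup : ∀ p q a b u → p * (1 + q) * (a * b * u) ≡ p * a * ((1 + q) * b) * u
      regroup = solve-∀
      r+1!≡ : suc r ! ≡ p ^ suc q * suc q ! * u
      r+1!≡ = trans (cong₂ _*_ r+1≡p[q+1] r!≡) (regroup p q (p ^ q) (q !) u)

    -- v_p(r!) ≤ r: with q = ⌊r/p⌋ we have r! = p^q·q!·u, p ∤ u, and v_p(q!) ≤ q by
    -- induction, so v_p(r!) ≤ 2q ≤ r.
    p^k∣m*r!⇒p^k∣m*p^r : ∀ r {k m} → p ^ k ∣ m * r ! → p ^ k ∣ m * p ^ r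
    p^k∣m*r!⇒p^k∣m*p^r = <-rec _ step
      where
      step : ∀ r → (∀ {y} → y < r → ∀ {k m} → p ^ k ∣ m * y ! → p ^ k ∣ m * p ^ y) →
             ∀ {k m} → p ^ k ∣ m * r ! → p ^ k ∣ m * p ^ r
      step zero      _   p^k∣m = p^k∣m
      step r@(suc _) rec {k} {m} p^k∣m*r!
        with factorialSplit-+ {r / p} (r % p) (m%n<n r p) (factorialSplit-* (r / p))
      ... | u , p∤u , r!≡ =
        ∣-trans (rec q<r {k} {m * p ^ q}
                  (p^k∣m*n⇒p^k∣m p-prime p∤u k (m * p ^ q * q !) p^k∣m*p^q*q!*u))
                (subst (_∣ m * p ^ r) (sym (*-assoc m (p ^ q) (p ^ q)))
                  (*-monoʳ-∣ m (subst (_∣ p ^ r) (^-distribˡ-+-* p q q) (^-monoʳ-∣ p q+q≤r))))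
        where
        open ≡-Reasoning
        q = r / p
        t = r % p
        2≤p : 2 ≤ p
        2≤p = nonTrivial⇒n>1 p {{prime⇒nonTrivial p-prime}}
        q<r : q < r
        q<r = m/n<m r p 2≤p
        r≡pq+t : r ≡ p * q + t
        r≡pq+t = trans (m≡m%n+[m/n]*n r p) (trans (+-comm t (q * p)) (cong (_+ t) (*-comm q p)))
        q+q≤r : q + q ≤ r
        q+q≤r = ≤-trans (subst (_≤ p * q) (cong (q +_) (+-identityʳ q)) (*-monoˡ-≤ q 2≤p))
                        (≤-trans (m≤m+n (p * q) t) (≤-reflexive (sym r≡pq+t)))
        regroup : ∀ m a b u → m * (a * b * u) ≡ m * a * b * u
        regroup = solve-∀
        p^k∣m*p^q*q!*u : p ^ k ∣ m * p ^ q * q ! * u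
        p^k∣m*p^q*q!*u = subst (p ^ k ∣_) (begin
            m * r !                  ≡⟨ cong (λ n → m * n !) r≡pq+t ⟩
            m * (p * q + t) !        ≡⟨ cong (m *_) r!≡ ⟩
            m * (p ^ q * q ! * u)    ≡⟨ regroup m (p ^ q) (q !) u ⟩
            m * p ^ q * q ! * u      ∎) p^k∣m*r!

  p^vAux∣ : ∀ fuel p n → p ^ vAux fuel p n ∣ n
  p^vAux∣ zero       p               n         = 1∣ n
  p^vAux∣ (suc fuel) zero            n         = 1∣ n
  p^vAux∣ (suc fuel) (suc zero)      n         = 1∣ n
  p^vAux∣ (suc fuel) (suc (suc q))   zero      = 1∣ 0
  p^vAux∣ (suc fuel) p@(suc (suc q)) n@(suc _) with (n % p) ≡ᵇ 0 in n%p≡ᵇ0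
  ... | false = 1∣ n
  ... | true  =
    subst (p * p ^ vAux fuel p (n / p) ∣_) (m*[n/m]≡n p∣n) (*-monoʳ-∣ p (p^vAux∣ fuel p (n / p)))
    where
    p∣n : p ∣ n
    p∣n = m%n≡0⇒n∣m n p (≡ᵇ⇒≡ (n % p) 0 (subst T (sym n%p≡ᵇ0) _))

  p^vp[n]∣n : ∀ p n → p ^ vp p n ∣ n
  p^vp[n]∣n p n = p^vAux∣ n p n

  n!∣fallingFactorial*[e∸i]! : ∀ {n e} → n ≤ e → ∀ i → n ! ∣ fallingFactorial e i * (e ∸ i) !
  n!∣fallingFactorial*[e∸i]! {n} {e} n≤e i with i ≤? e
  ... | yes i≤e = ∣-trans (m≤n⇒m!∣n! n≤e) (∣-reflexive (sym (fallingFactorial*[e∸i]!≡e! i≤e)))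
  ... | no  i≰e = subst (λ f → n ! ∣ f * (e ∸ i) !) (sym (fallingFactorial-> (≰⇒> i≰e))) ((n !) ∣0)

  ∣m*r!⇒∣m*0^r : ∀ {a} m r → a ∣ m * r ! → a ∣ m * 0 ^ r
  ∣m*r!⇒∣m*0^r     m zero    a∣m = a∣m
  ∣m*r!⇒∣m*0^r {a} m (suc r) _   = subst (a ∣_) (sym (*-zeroʳ m)) (a ∣0)

  p^k∣m*r!⇒p^k∣m*c^r : ∀ {p c k} m r → Prime p → p ∣ c → p ^ k ∣ m * r ! → p ^ k ∣ m * c ^ r
  p^k∣m*r!⇒p^k∣m*c^r {k = k} m r p-prime p∣c p^k∣m*r! =
    ∣-trans (p^k∣m*r!⇒p^k∣m*p^r p-prime r {k} {m} p^k∣m*r!) (*-monoʳ-∣ m (^-monoˡ-∣ r p∣c))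

-- Sums and products over ranges
module _ where
  open import Data.Nat
  open import Data.Nat.Properties
  open import Data.Nat.Divisibility
  open import Data.Nat.DivMod using (m<n*o⇒m/o<n)
  open import Data.Nat.ListAction.Properties using (sum-++)
  open import Data.Nat.Tactic.RingSolver using (solve-∀)
  open import Data.List using (upTo; _++_; [_])
  open import Data.List.Properties using (map-++; upTo-∷ʳ)
  open import Data.List.Membership.Propositional using (_∈_)
  open import Data.List.Relation.Unary.Any using (here; there)
  open import Relation.Nullary using (yes; no; contradiction)

  ^sum∣product : ∀ {a} (f g : ℕ → ℕ) xs → (∀ x → a ^ f x ∣ g x) →
    a ^ sum (map f xs) ∣ product (map g xs)
  ^sum∣product f g []       _ = ∣-refl
  ^sum∣product {a} f g (x ∷ xs) a^f∣g =
    subst (_∣ g x * product (map g xs)) (sym (^-distribˡ-+-* a (f x) _))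
      (*-pres-∣ (a^f∣g x) (^sum∣product f g xs a^f∣g))

  ∈⇒*^sum∣product : ∀ {a b x} (f g : ℕ → ℕ) {xs} → x ∈ xs → b * a ^ f x ∣ g x →
    (∀ y → a ^ f y ∣ g y) → b * a ^ sum (map f xs) ∣ product (map g xs)
  ∈⇒*^sum∣product {a} {b} f g {x ∷ xs} (here refl) b*a^f∣g a^f∣g =
    subst (_∣ g x * product (map g xs))
      (trans (regroup b (a ^ f x) _) (cong (b *_) (sym (^-distribˡ-+-* a (f x) _))))
      (*-pres-∣ b*a^f∣g (^sum∣product f g xs a^f∣g))
    where
    regroup : ∀ b c d → b * c * d ≡ b * (c * d)
    regroup = solve-∀
  ∈⇒*^sum∣product {a} {b} f g {y ∷ xs} (there x∈xs) b*a^f∣g a^f∣g =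
    subst (_∣ g y * product (map g xs))
      (trans (swap (a ^ f y) b _) (cong (b *_) (sym (^-distribˡ-+-* a (f y) _))))
      (*-pres-∣ (a^f∣g y) (∈⇒*^sum∣product {b = b} f g x∈xs b*a^f∣g a^f∣g))
    where
    swap : ∀ c b d → c * (b * d) ≡ b * (c * d)
    swap = solve-∀

  foldr-⊓-≤ : ∀ x ys {y} → y ∈ x ∷ ys → foldr _⊓_ x ys ≤ y
  foldr-⊓-≤ x []       (here refl)         = ≤-refl
  foldr-⊓-≤ x (z ∷ zs) (here refl)         = ≤-trans (m⊓n≤n z _) (foldr-⊓-≤ x zs (here refl))
  foldr-⊓-≤ x (z ∷ zs) (there (here refl)) = m⊓n≤m z _
  foldr-⊓-≤ x (z ∷ zs) (there (there y∈)) = ≤-trans (m⊓n≤n z _) (foldr-⊓-≤ x zs (there y∈))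

  sum-map-upTo-suc : ∀ f t → sum (map f (upTo (suc t))) ≡ sum (map f (upTo t)) + f t
  sum-map-upTo-suc f t = begin
    sum (map f (upTo (suc t)))           ≡⟨ cong (λ xs → sum (map f xs)) (sym (upTo-∷ʳ t)) ⟩
    sum (map f (upTo t ++ [ t ]))        ≡⟨ cong sum (map-++ f (upTo t) [ t ]) ⟩
    sum (map f (upTo t) ++ [ f t ])      ≡⟨ sum-++ (map f (upTo t)) [ f t ] ⟩
    sum (map f (upTo t)) + (f t + 0)     ≡⟨ cong (sum (map f (upTo t)) +_) (+-identityʳ (f t)) ⟩
    sum (map f (upTo t)) + f t           ∎
    where open ≡-Reasoning

  partialSum : (ℕ → ℕ) → ℕ → ℕ
  partialSum g zero    = 0
  partialSum g (suc a) = partialSum g a + g (suc a)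

  multipleIndicator : ℕ → ℕ → ℕ
  multipleIndicator p d with p ∣? d
  ... | yes _ = 1
  ... | no  _ = 0

  <[1+partialSum]*p : ∀ p .{{_ : NonZero p}} a → a < suc (partialSum (multipleIndicator p) a) * p
  <[1+partialSum]*p p zero = subst (0 <_) (sym (+-identityʳ p)) (>-nonZero⁻¹ p)
  <[1+partialSum]*p p (suc a) with p ∣? suc a | <[1+partialSum]*p p a
  ... | yes _ | a<S*p = begin-strict
      suc a          ≤⟨ a<S*p ⟩
      suc S * p      <⟨ m<m+n (suc S * p) (>-nonZero⁻¹ p) ⟩
      suc S * p + p  ≡⟨ regroup S p ⟩
      suc (S + 1) * p ∎
    where
    open ≤-Reasoning
    S = partialSum (multipleIndicator p) a
    regroup : ∀ s p → (1 + s) * p + p ≡ (1 + (s + 1)) * p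
    regroup = solve-∀
  ... | no p∤a+1 | a<S*p =
    subst (λ s → suc a < suc s * p) (sym (+-identityʳ S))
      (≤∧≢⇒< a<S*p (λ a+1≡S*p → p∤a+1 (divides (suc S) a+1≡S*p)))
    where
    S = partialSum (multipleIndicator p) a

  floorDiv≤partialSum : ∀ a p → floorDiv a p ≤ partialSum (multipleIndicator p) a
  floorDiv≤partialSum a zero    = z≤n
  floorDiv≤partialSum a (suc q) = ≤-pred (m<n*o⇒m/o<n (<[1+partialSum]*p (suc q) a))

  module _ (g : ℕ → ℕ) (j : ℕ) where
    offCentreWeight : ℕ → ℕ
    offCentreWeight i with i ≟ j
    ... | yes _ = 0
    ... | no  _ = g ∣ i - j ∣

    offCentreWeight-< : ∀ {i} → i < j → offCentreWeight i ≡ g (j ∸ i)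
    offCentreWeight-< {i} i<j with i ≟ j
    ... | yes i≡j = contradiction i≡j (<⇒≢ i<j)
    ... | no  _   = cong g (m≤n⇒∣m-n∣≡n∸m (<⇒≤ i<j))

    offCentreWeight-> : ∀ {i} → j < i → offCentreWeight i ≡ g (i ∸ j)
    offCentreWeight-> {i} j<i with i ≟ j
    ... | yes i≡j = contradiction (sym i≡j) (<⇒≢ j<i)
    ... | no  _   = cong g (m≤n⇒∣n-m∣≡n∸m (<⇒≤ j<i))

    offCentreWeight-centre : offCentreWeight j ≡ 0
    offCentreWeight-centre with j ≟ j
    ... | yes _   = refl
    ... | no  j≢j = contradiction refl j≢j

    sum-offCentreWeight-below : ∀ t → t ≤ j →
      sum (map offCentreWeight (upTo t)) + partialSum g (j ∸ t) ≡ partialSum g j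
    sum-offCentreWeight-below zero    _     = refl
    sum-offCentreWeight-below (suc t) t+1≤j = begin
        sum (map offCentreWeight (upTo (suc t))) + partialSum g (j ∸ suc t)
      ≡⟨ cong (_+ partialSum g (j ∸ suc t)) (sum-map-upTo-suc offCentreWeight t) ⟩
        W + offCentreWeight t + partialSum g (j ∸ suc t)
      ≡⟨ cong (λ w → W + w + partialSum g (j ∸ suc t)) (offCentreWeight-< t+1≤j) ⟩
        W + g (j ∸ t) + partialSum g (j ∸ suc t)
      ≡⟨ regroup W (g (j ∸ t)) (partialSum g (j ∸ suc t)) ⟩
        W + (partialSum g (j ∸ suc t) + g (j ∸ t))
      ≡⟨ cong (λ d → W + (partialSum g (j ∸ suc t) + g d)) j∸t≡1+[j∸t+1] ⟩
        W + partialSum g (suc (j ∸ suc t))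
      ≡⟨ cong (λ d → W + partialSum g d) (sym j∸t≡1+[j∸t+1]) ⟩
        W + partialSum g (j ∸ t)
      ≡⟨ sum-offCentreWeight-below t (<⇒≤ t+1≤j) ⟩
        partialSum g j ∎
      where
      open ≡-Reasoning
      W = sum (map offCentreWeight (upTo t))
      j∸t≡1+[j∸t+1] : j ∸ t ≡ suc (j ∸ suc t)
      j∸t≡1+[j∸t+1] = +-∸-assoc 1 t+1≤j
      regroup : ∀ a b c → a + b + c ≡ a + (c + b)
      regroup = solve-∀

    sum-offCentreWeight-above : ∀ c →
      sum (map offCentreWeight (upTo (suc (c + j)))) ≡ partialSum g j + partialSum g c
    sum-offCentreWeight-above zero    = begin
        sum (map offCentreWeight (upTo (suc j)))
                                    ≡⟨ sum-map-upTo-suc offCentreWeight j ⟩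
        W + offCentreWeight j       ≡⟨ cong (W +_) offCentreWeight-centre ⟩
        W + 0                       ≡⟨ cong (λ d → W + partialSum g d) (sym (n∸n≡0 j)) ⟩
        W + partialSum g (j ∸ j)    ≡⟨ sum-offCentreWeight-below j ≤-refl ⟩
        partialSum g j              ≡⟨ +-identityʳ (partialSum g j) ⟨
        partialSum g j + 0          ∎
      where
      open ≡-Reasoning
      W = sum (map offCentreWeight (upTo j))
    sum-offCentreWeight-above (suc c) = begin
        sum (map offCentreWeight (upTo (suc (suc c + j))))
      ≡⟨ sum-map-upTo-suc offCentreWeight (suc c + j) ⟩
        sum (map offCentreWeight (upTo (suc (c + j)))) + offCentreWeight (suc c + j)
      ≡⟨ cong₂ _+_ (sum-offCentreWeight-above c)
                   (trans (offCentreWeight-> (s≤s (m≤n+m j c))) (cong g (m+n∸n≡m (suc c) j))) ⟩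
        partialSum g j + partialSum g c + g (suc c)
      ≡⟨ +-assoc (partialSum g j) (partialSum g c) (g (suc c)) ⟩
        partialSum g j + partialSum g (suc c) ∎
      where open ≡-Reasoning

    sum-offCentreWeight : ∀ {m} → j ≤ m →
      sum (map offCentreWeight (upTo (suc m))) ≡ partialSum g j + partialSum g (m ∸ j)
    sum-offCentreWeight {m} j≤m =
      trans (cong (λ t → sum (map offCentreWeight (upTo (suc t)))) (sym (m∸n+n≡m j≤m)))
            (sum-offCentreWeight-above (m ∸ j))

-- The divisibility for one prime
module _ where
  open import Data.Nat
  open import Data.Nat.Properties
  open import Data.Nat.Divisibility
  open import Data.Nat.Primality using (Prime)
  open import Data.Integer using (+_; _-_)
  import Data.Integer as ℤ
  open import Data.Integer.Divisibility.Signed using (∣⇒∣ᵤ)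
  open import Data.List using (upTo)
  open import Data.List.Membership.Propositional.Properties using (∈-upTo⁺; ∈-map⁺)
  open import Data.Bool using (true; false)
  open import Relation.Nullary using (yes; no; contradiction)
  open import Function using (_$_)

  l∸1≤lk : ∀ l k i → l ∸ 1 ≤ lk l k i
  l∸1≤lk l k i with i ≡ᵇ k
  ... | true  = ≤-refl
  ... | false = m∸n≤m l 1

  mu≤muTerm : ∀ m p {j} → j ≤ m → mu m p ≤ muTerm m p j
  mu≤muTerm m p j≤m = foldr-⊓-≤ (muTerm m p 0) _ (∈-map⁺ (muTerm m p) (∈-upTo⁺ (s≤s j≤m)))

  module _ {p : ℕ} (p-prime : Prime p) {n V : ℕ} (p^V∣n! : p ^ V ∣ n !) (j : ℕ) where
    modulus : ℕ → ℕ
    modulus i with i ≟ j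
    ... | yes _ = n !
    ... | no  _ = (p ^ V) ^ multipleIndicator p ∣ i - j ∣

    pCount : ℕ → ℕ
    pCount = offCentreWeight (multipleIndicator p) j

    [p^V]^pCount∣modulus : ∀ i → (p ^ V) ^ pCount i ∣ modulus i
    [p^V]^pCount∣modulus i with i ≟ j
    ... | yes _ = 1∣ (n !)
    ... | no  _ = ∣-refl

    n!*[p^V]^pCount∣modulus : n ! * (p ^ V) ^ pCount j ∣ modulus j
    n!*[p^V]^pCount∣modulus with j ≟ j
    ... | yes _   = ∣-reflexive (*-identityʳ (n !))
    ... | no  j≢j = contradiction refl j≢j

    modulus-hurwitzDivisible : ∀ i {e} → n ≤ e →
      HurwitzDivisible (modulus i) (ppow (linearFactor (+ i - + j)) e)
    modulus-hurwitzDivisible i {e} n≤e with i ≟ j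
    ... | yes refl = linearFactor^-hurwitzDivisible _ e λ r →
      subst (λ c → n ! ∣ fallingFactorial e r * c ^ (e ∸ r))
        (sym (trans (∣+m-+n∣≡∣m-n∣ i i) (∣n-n∣≡0 i)))
        (∣m*r!⇒∣m*0^r (fallingFactorial e r) (e ∸ r) (n!∣fallingFactorial*[e∸i]! n≤e r))
    ... | no _ with p ∣? ∣ i - j ∣
    ...   | yes p∣∣i-j∣ = linearFactor^-hurwitzDivisible _ e λ r →
      ∣-trans (∣-reflexive (*-identityʳ (p ^ V))) $
        p^k∣m*r!⇒p^k∣m*c^r {k = V} (fallingFactorial e r) (e ∸ r) p-prime
          (subst (p ∣_) (sym (∣+m-+n∣≡∣m-n∣ i j)) p∣∣i-j∣)
          (∣-trans p^V∣n! (n!∣fallingFactorial*[e∸i]! n≤e r))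
    ...   | no _ = hurwitzDivisible-1 (ppow (linearFactor (+ i - + j)) e)

    sigmaPoly-hurwitzDivisible : ∀ m l k → n ≤ l ∸ 1 →
      HurwitzDivisible (product (map modulus (upTo (suc m)))) (sigmaPoly m l k j)
    sigmaPoly-hurwitzDivisible m l k n≤l∸1 =
      foldr-pmul-hurwitzDivisible modulus (λ i → ppow (linearFactor (+ i - + j)) (lk l k i))
        (upTo (suc m)) (λ i → modulus-hurwitzDivisible i (≤-trans n≤l∸1 (l∸1≤lk l k i)))

    n!*[p^V]^count∣product-modulus : ∀ {m} → j ≤ m →
      n ! * (p ^ V) ^ (partialSum (multipleIndicator p) j + partialSum (multipleIndicator p) (m ∸ j))
        ∣ product (map modulus (upTo (suc m)))
    n!*[p^V]^count∣product-modulus {m} j≤m =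
      subst (λ c → n ! * (p ^ V) ^ c ∣ product (map modulus (upTo (suc m))))
        (sum-offCentreWeight (multipleIndicator p) j j≤m)
        (∈⇒*^sum∣product {b = n !} pCount modulus (∈-upTo⁺ (s≤s j≤m))
          n!*[p^V]^pCount∣modulus [p^V]^pCount∣modulus)

  BstarNum-prime-divisible : ∀ m l k {j} i {p} → j ≤ m → Prime p →
    (l ∸ 1) ! * p ^ (mu m p * vp p ((l ∸ 1) !)) ∣ ℤ.∣ BstarNum m l k j i ∣
  BstarNum-prime-divisible m l k {j} i {p} j≤m p-prime =
    ∣-trans (*-monoʳ-∣ (n !) p^[μV]∣[p^V]^count)
      (∣-trans (n!*[p^V]^count∣product-modulus p-prime {V = V} p^V∣n! j j≤m)
        (∣⇒∣ᵤ (sigmaPoly-hurwitzDivisible p-prime {V = V} p^V∣n! j m l k ≤-refl i)))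
    where
    n = l ∸ 1
    V = vp p (n !)
    p^V∣n! : p ^ V ∣ n !
    p^V∣n! = p^vp[n]∣n p (n !)
    count = partialSum (multipleIndicator p) j + partialSum (multipleIndicator p) (m ∸ j)
    μ≤count : mu m p ≤ count
    μ≤count = ≤-trans (mu≤muTerm m p j≤m)
                      (+-mono-≤ (floorDiv≤partialSum j p) (floorDiv≤partialSum (m ∸ j) p))
    p^[μV]∣[p^V]^count : p ^ (mu m p * V) ∣ (p ^ V) ^ count
    p^[μV]∣[p^V]^count = subst (p ^ (mu m p * V) ∣_) (sym (^-*-assoc p V count))
      (^-monoʳ-∣ p (subst (_≤ V * count) (*-comm V (mu m p)) (*-monoʳ-≤ V μ≤count)))

-- Products of distinct prime powers
module _ where
  open import Data.Nat
  open import Data.Nat.Properties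
  open import Data.Nat.Divisibility
  open import Data.Nat.Primality using (Prime; prime?; prime[2]; euclidsLemma; prime⇒irreducible)
  open import Data.Bool using (Bool; true; false; _∧_; if_then_else_)
  open import Data.List.Relation.Unary.All using (All; []; _∷_)
  open import Data.List.Relation.Unary.Unique.Propositional using (Unique)
  open import Data.List.Relation.Unary.AllPairs using ([]; _∷_)
  open import Data.Sum using (inj₁; inj₂)
  open import Relation.Nullary using (¬_; yes; no; does)

  module _ (keep : ℕ → Bool) (E : ℕ → ℕ) where
    primePowerProduct : List ℕ → ℕ
    primePowerProduct = foldr (λ p acc → if does (prime? p) ∧ keep p then p ^ E p * acc else acc) 1

    prime∤primePowerProduct : ∀ {q} xs → Prime q → All (q ≢_) xs → ¬ q ∣ primePowerProduct xs
    prime∤primePowerProduct []       q-prime []          = prime∤1 q-prime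
    prime∤primePowerProduct (x ∷ xs) q-prime (q≢x ∷ q∉xs) q∣ with prime? x | keep x
    ... | no _        | _     = prime∤primePowerProduct xs q-prime q∉xs q∣
    ... | yes _       | false = prime∤primePowerProduct xs q-prime q∉xs q∣
    ... | yes x-prime | true  with euclidsLemma (x ^ E x) (primePowerProduct xs) q-prime q∣
    ...   | inj₂ q∣rest = prime∤primePowerProduct xs q-prime q∉xs q∣rest
    ...   | inj₁ q∣x^E with prime⇒irreducible x-prime (prime∣^⇒prime∣ x (E x) q-prime q∣x^E)
    ...     | inj₁ q≡1 = prime∤1 q-prime (subst (_∣ 1) (sym q≡1) ∣-refl)
    ...     | inj₂ q≡x = q≢x q≡x

    primePowerProduct-∣ : ∀ {Y} xs → Unique xs → (∀ p → Prime p → p ^ E p ∣ Y) →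
      primePowerProduct xs ∣ Y
    primePowerProduct-∣ {Y} []       _                p^E∣Y = 1∣ Y
    primePowerProduct-∣ {Y} (x ∷ xs) (x∉xs ∷ unique) p^E∣Y with prime? x | keep x
    ... | no _        | _     = primePowerProduct-∣ xs unique p^E∣Y
    ... | yes _       | false = primePowerProduct-∣ xs unique p^E∣Y
    ... | yes x-prime | true  with primePowerProduct-∣ xs unique p^E∣Y
    ...   | divides t refl = *-monoˡ-∣ (primePowerProduct xs)
            (p^k∣m*n⇒p^k∣m x-prime (prime∤primePowerProduct xs x-prime x∉xs) (E x) t (p^E∣Y x x-prime))

    primePowerProduct*-∣ : ∀ {a X} .{{_ : NonZero a}} xs → Unique xs →
      (∀ p → Prime p → a * p ^ E p ∣ X) → primePowerProduct xs * a ∣ X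
    primePowerProduct*-∣ {a} xs unique a*p^E∣X with m*n∣⇒m∣ a (2 ^ E 2) (a*p^E∣X 2 prime[2])
    ... | divides Y refl = *-monoˡ-∣ a (primePowerProduct-∣ xs unique p^E∣Y)
      where
      p^E∣Y : ∀ p → Prime p → p ^ E p ∣ Y
      p^E∣Y p p-prime = *-cancelˡ-∣ a (subst (a * p ^ E p ∣_) (*-comm Y a) (a*p^E∣X p p-prime))

module _ where
  open import Data.Nat using (ℕ; _≤_; _*_; _∸_; _!; suc; _≤ᵇ_)
  open import Data.Nat.Properties using (_!≢0)
  open import Data.Integer using (+_)
  open import Data.Integer.Divisibility using (_∣_)
  open import Data.List using (upTo)
  open import Data.List.Relation.Unary.Unique.Propositional.Properties using (upTo⁺)

  corollary6p3 : (m l : ℕ) → 1 ≤ m → 1 ≤ l →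
    (k j : ℕ) → k ≤ m → j ≤ m →
    (i : ℕ) → i ≤ Lval m l →
    (+ (Dml m l * ((l ∸ 1) !))) ∣ BstarNum m l k j i
  corollary6p3 m l _ _ k j _ j≤m i _ =
    primePowerProduct*-∣ (λ p → 2 * p ≤ᵇ suc m) (λ p → mu m p * vp p ((l ∸ 1) !)) {{(l ∸ 1) !≢0}}
      (upTo (suc (suc m))) (upTo⁺ (suc (suc m)))
      (λ p p-prime → BstarNum-prime-divisible m l k i j≤m p-prime)
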